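{- Let $p$ and $q$ be primes with $p\mid q-1$, let $r\in\mathbb Z$ satisfy $r^p\equiv 1\pmod q$ and $r\not\equiv1\pmod q$, let $G=\langle \alpha,\tau:\ \alpha^q=1,\ \tau^p=1,\ \alpha\tau=\tau\alpha^r\rangle$, and let $G'=[G,G]$ (which equals $\langle\alpha\rangle$). Let $S$ be a sequence over $G'\setminus\{1\}$ and let $g_1,g_2\in G\setminus G'$ with $g_1g_2\notin G'$. Then $$|\pi(g_1\cdot g_2\cdot S)|\geq \min\{q,\ 2|S|+1\},$$ where $g_1\cdot g_2\cdot S$ denotes the sequence obtained by adjoining the terms $g_1$ and $g_2$ to $S$.
   Context: A sequence over a group $G$ is a finite unordered list of elements of $G$ with repetition allowed; its length $|S|$ is its number of terms with multiplicity. For a sequence $S$, $\pi(S)\subseteq G$ denotes the set of all products $g_1g_2\cdots g_\ell$ obtained over all orderings $g_1,\dots,g_\ell$ of the terms of $S$. -}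

module Defs where

open import Data.Nat using (ℕ; zero; suc; _+_; _*_; _^_; NonZero)
open import Data.Nat.DivMod using (_mod_)
open import Data.Fin using (Fin; toℕ)
import Data.Fin as Fin
open import Data.Integer using (ℤ)
open import Data.Integer.DivMod using (_%ℕ_)
open import Data.Product using (Σ; _×_; _,_; ∃)
open import Data.List using (List; []; _∷_; foldr)
open import Data.List.Relation.Binary.Permutation.Propositional using (_↭_)
open import Relation.Binary.PropositionalEquality using (_≡_)

-- The element  τ^j α^i  is represented by the pair (i , j) with i : Fin q, j : Fin p.
-- Multiplication: (τ^j α^i)(τ^k α^l) = τ^(j+k) α^(i r^k + l)   (since α^i τ^k = τ^k α^(i r^k)).
record Met (q p : ℕ) : Set where
  constructor ⟨_,_⟩
  field
    aexp : Fin q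
    texp : Fin p
open Met public

module _ (q p : ℕ) .{{_ : NonZero q}} .{{_ : NonZero p}} (r : ℤ) where

  -- r reduced modulo q (the group only depends on r mod q)
  rq : ℕ
  rq = r %ℕ q

  mul : Met q p → Met q p → Met q p
  mul ⟨ i , j ⟩ ⟨ l , k ⟩ =
    ⟨ (toℕ i * rq ^ toℕ k + toℕ l) mod q , (toℕ j + toℕ k) mod p ⟩

  one : Met q p
  one = ⟨ 0 mod q , 0 mod p ⟩

  prod : List (Met q p) → Met q p
  prod = foldr mul one

  -- g ∈ π(S): g is the product of the terms of S in some ordering
  -- (sequences are lists; orderings are permutations of the list)
  _∈π_ : Met q p → List (Met q p) → Set
  g ∈π S = Σ (List (Met q p)) λ T → (T ↭ S) × (prod T ≡ g)

InG' : {q p : ℕ} → Met q p → Set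
InG' g = toℕ (texp g) ≡ 0

IsOne : {q p : ℕ} → Met q p → Set
IsOne g = (toℕ (aexp g) ≡ 0) × (toℕ (texp g) ≡ 0)

module Submission where

-- Write g₁ = τ^j α^x and g₂ = τ^k α^y, and let s = r^k and t = r^(j+k) modulo q.  In a product of
-- g₁ · g₂ · S in which g₁ precedes g₂, a term α^a of S contributes a t, a s or a to the α-exponent
-- according as it stands before g₁, between g₁ and g₂, or after g₂.  Hence π(g₁ · g₂ · S) contains
-- τ^(j+k) α^v for every v in the iterated sumset {x s + y} + {a t, a s, a} + ⋯ in ℤ_q, one summand
-- per term α^a of S.  As r has order p modulo q, the multipliers t, s, 1 are pairwise incongruent,
-- so every summand consists of three distinct residues (a ≢ 0, as 1 ∉ S), and adding three distinct
-- residues to a set A ⊆ ℤ_q produces at least min(q, |A| + 2) elements: otherwise the sumset has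
-- |A| or |A| + 1 elements, and comparing its first and second power sums with those of the
-- translates A + b forces q ∣ |A| or q ∣ |A| (|A| + 1).

open import Defs
open import Data.Nat as ℕ using (ℕ; zero; suc; NonZero; _<_; _≤_; _⊓_; s≤s; z≤n)
import Data.Nat.Properties as ℕ
import Data.Nat.Divisibility as ℕ
import Data.Nat.Tactic.RingSolver as ℕ-Solver
open import Data.Nat.Base using (nonTrivial⇒n>1)
open import Data.Nat.DivMod using (_mod_; _%_; _/_; m%n<n; m<n⇒m%n≡m; m≡m%n+[m/n]*n)
open import Data.Nat.Primality using (Prime; euclidsLemma; prime⇒nonTrivial)
open import Data.Nat.Coprimality using (prime⇒coprime; coprime-Bézout)
open import Data.Nat.GCD using (module Bézout)
open import Data.Integer as ℤ using (ℤ; +_; -_; _-_; 0ℤ; 1ℤ; _^_; ∣_∣)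
import Data.Integer.Properties as ℤ
open import Data.Integer.DivMod using (_%ℕ_; _/ℕ_; a≡a%ℕn+[a/ℕn]*n)
import Data.Integer.Divisibility.Signed as Signed
open import Data.Integer.Tactic.RingSolver using (solve-∀)
open import Data.Fin using (Fin; toℕ; _≟_)
open import Data.Fin.Properties using (toℕ-fromℕ<; toℕ-injective; toℕ<n)
open import Data.List using (List; []; _∷_; _++_; [_]; length; map; foldr; deduplicate; cartesianProductWith)
open import Data.List.Properties using (length-++; length-map; ++-identityʳ)
open import Data.List.Membership.Propositional using (_∈_)
open import Data.List.Membership.Propositional.Properties
  using (∈-∃++; ∈-map⁻; ∈-deduplicate⁺; ∈-deduplicate⁻; ∈-cartesianProductWith⁺; ∈-cartesianProductWith⁻)
open import Data.List.Relation.Binary.Subset.Propositional using (_⊆_)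
open import Data.List.Relation.Unary.Any using (here; there)
open import Data.List.Relation.Unary.All as All using (All; []; _∷_; tabulate)
import Data.List.Relation.Unary.All.Properties as All
open import Data.List.Relation.Unary.AllPairs using ([]; _∷_)
open import Data.List.Relation.Unary.Unique.Propositional using (Unique)
import Data.List.Relation.Unary.Unique.Propositional.Properties as Unique
open import Data.List.Relation.Unary.Unique.DecPropositional.Properties using (deduplicate-!)
open import Data.List.Relation.Binary.Permutation.Propositional
  using (_↭_; ↭-refl; ↭-prep; ↭-swap; ↭-sym; ↭-trans; ↭⇒↭ₛ)
open import Data.List.Relation.Binary.Permutation.Propositional.Properties
  using (∈-resp-↭; ↭-length; shift; ++-comm; ++⁺ˡ; map⁺)
import Data.List.Relation.Binary.Permutation.Setoid.Properties as PermutationSetoid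
open import Data.Product using (∃; ∃₂; _×_; _,_; proj₁; proj₂)
open import Data.Sum using (_⊎_; inj₁; inj₂; [_,_]′)
open import Data.Empty using (⊥-elim)
open import Function using (_∘_; id)
open import Relation.Nullary using (¬_)
open import Relation.Binary using (IsEquivalence; Setoid)
open import Relation.Binary.PropositionalEquality
  using (_≡_; _≢_; refl; sym; trans; cong; cong₂; subst; setoid)
import Relation.Binary.Reasoning.Setoid as SetoidReasoning

toℕ-mod : ∀ n d .{{_ : NonZero d}} → toℕ (n mod d) ≡ n % d
toℕ-mod n d = toℕ-fromℕ< (m%n<n n d)

toℕ-mod-toℕ : ∀ {d} .{{_ : NonZero d}} (i : Fin d) → toℕ i mod d ≡ i
toℕ-mod-toℕ {d} i = toℕ-injective (trans (toℕ-mod (toℕ i) d) (m<n⇒m%n≡m (toℕ<n i)))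

pos-^ : ∀ n k → + (n ℕ.^ k) ≡ (+ n) ^ k
pos-^ n zero    = refl
pos-^ n (suc k) = trans (ℤ.pos-* n (n ℕ.^ k)) (cong (+ n ℤ.*_) (pos-^ n k))

⊓-+-mono-≤ : ∀ {q x y} c → q ⊓ x ≤ y → q ⊓ (x ℕ.+ c) ≤ q ⊓ (y ℕ.+ c)
⊓-+-mono-≤ {q} {x} {y} c q⊓x≤y = ℕ.⊓-glb (ℕ.m⊓n≤m q _) (begin
  q ⊓ (x ℕ.+ c)          ≤⟨ ℕ.⊓-mono-≤ (ℕ.m≤m+n q c) ℕ.≤-refl ⟩
  (q ℕ.+ c) ⊓ (x ℕ.+ c)  ≡⟨ ℕ.+-distribʳ-⊓ c q x ⟨
  q ⊓ x ℕ.+ c            ≤⟨ ℕ.+-monoˡ-≤ c q⊓x≤y ⟩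
  y ℕ.+ c                ∎)
  where open ℕ.≤-Reasoning

module _ {A : Set} where

  Unique-resp-↭ : ∀ {xs ys : List A} → xs ↭ ys → Unique xs → Unique ys
  Unique-resp-↭ p = PermutationSetoid.Unique-resp-↭ (setoid A) (↭⇒↭ₛ p)

  ∈⇒↭∷ : ∀ {x : A} {ys} → x ∈ ys → ∃ λ ys′ → ys ↭ x ∷ ys′
  ∈⇒↭∷ {x} x∈ys with as , bs , refl ← ∈-∃++ x∈ys = as ++ bs , shift x as bs

  ⊆-remove : ∀ {x : A} {xs ys ys′} → Unique (x ∷ xs) → ys ↭ x ∷ ys′ → x ∷ xs ⊆ ys → xs ⊆ ys′
  ⊆-remove (x∉xs ∷ _) ys↭x∷ys′ xs⊆ys z∈xs with ∈-resp-↭ ys↭x∷ys′ (xs⊆ys (there z∈xs))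
  ... | here refl   = ⊥-elim (All.lookup x∉xs z∈xs refl)
  ... | there z∈ys′ = z∈ys′

  ⊆-complement : ∀ {xs ys : List A} → Unique xs → Unique ys → xs ⊆ ys → ∃ λ zs → ys ↭ zs ++ xs
  ⊆-complement {[]}     {ys} _ _ _ = ys , ↭-sym (++-comm ys [])
  ⊆-complement {x ∷ xs} {ys} xs!@(_ ∷ tail!) ys! xs⊆ys
    with ys′ , ys↭x∷ys′ ← ∈⇒↭∷ (xs⊆ys (here refl))
    with _ ∷ ys′! ← Unique-resp-↭ ys↭x∷ys′ ys!
    with zs , ys′↭zs++xs ← ⊆-complement tail! ys′! (⊆-remove xs! ys↭x∷ys′ xs⊆ys)
    = zs , ↭-trans ys↭x∷ys′ (↭-trans (↭-prep x ys′↭zs++xs) (↭-sym (shift x zs xs)))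

  ↭-++-length : ∀ zs {ys xs : List A} → ys ↭ zs ++ xs → length ys ≡ length zs ℕ.+ length xs
  ↭-++-length zs p = trans (↭-length p) (length-++ zs)

  Σ⟨_⟩ : (A → ℤ) → List A → ℤ
  Σ⟨ f ⟩ xs = foldr ℤ._+_ 0ℤ (map f xs)

  Σ-↭ : ∀ f {xs ys} → xs ↭ ys → Σ⟨ f ⟩ xs ≡ Σ⟨ f ⟩ ys
  Σ-↭ f p = PermutationSetoid.foldr-commMonoid (setoid ℤ) ℤ.+-0-isCommutativeMonoid (↭⇒↭ₛ (map⁺ f p))

module Congruence (q : ℕ) where

  open import Data.Integer using (_+_; _*_)
  open Signed using (_∣_; ∣-refl; ∣m∣n⇒∣m+n; ∣m∣n⇒∣m-n; ∣m⇒∣-m; ∣n⇒∣m*n; ∣⇒∣ᵤ; ∣ᵤ⇒∣)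

  -- x ≡ y (mod q), as a record so that x and y can be inferred from it
  infix 4 _≈_
  record _≈_ (x y : ℤ) : Set where
    constructor q∣-⇒≈
    field ≈⇒q∣- : + q ∣ x - y
  open _≈_ public

  -- abstract: otherwise the large proof terms of the solver get unfolded during type checking
  private abstract
    -[x-y]≡y-x : ∀ x y → - (x - y) ≡ y - x
    -[x-y]≡y-x = solve-∀
    x-y+y-z≡x-z : ∀ x y z → (x - y) + (y - z) ≡ x - z
    x-y+y-z≡x-z = solve-∀
    +-difference : ∀ x x′ y y′ → (x - x′) + (y - y′) ≡ (x + y) - (x′ + y′)
    +-difference = solve-∀
    *-difference : ∀ x x′ y y′ → y * (x - x′) + x′ * (y - y′) ≡ x * y - x′ * y′
    *-difference = solve-∀
    +-cancel-difference : ∀ x y b → (x + b) - (y + b) ≡ x - y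
    +-cancel-difference = solve-∀
    *-distrib-difference : ∀ c x y → c * (x - y) ≡ c * x - c * y
    *-distrib-difference = solve-∀
    -cong-difference : ∀ x x′ y y′ → (x - x′) - (y - y′) ≡ (x - y) - (x′ - y′)
    -cong-difference = solve-∀
    +-comm-difference : ∀ b x y → (b + x) - (b + y) ≡ x - y
    +-comm-difference = solve-∀
    quadratic-difference : ∀ a b c x y →
      (a * x * x + b * x + c) - (a * y * y + b * y + c) ≡ (x - y) * (a * (x + y) + b)
    quadratic-difference = solve-∀
    chord-difference : ∀ a b x y z → (a * (x + y) + b) - (a * (x + z) + b) ≡ a * (y - z)
    chord-difference = solve-∀
    -[k*d]≡r-[r+k*d] : ∀ r k d → - (k * d) ≡ r - (r + k * d)
    -[k*d]≡r-[r+k*d] = solve-∀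

  ≈-reflexive : ∀ {x y} → x ≡ y → x ≈ y
  ≈-reflexive {x} refl = q∣-⇒≈ (subst (+ q ∣_) (sym (ℤ.+-inverseʳ x)) (∣n⇒∣m*n 0ℤ ∣-refl))

  ≈-refl : ∀ {x} → x ≈ x
  ≈-refl = ≈-reflexive refl

  ≈-sym : ∀ {x y} → x ≈ y → y ≈ x
  ≈-sym {x} {y} (q∣-⇒≈ d) = q∣-⇒≈ (subst (+ q ∣_) (-[x-y]≡y-x x y) (∣m⇒∣-m d))

  ≈-trans : ∀ {x y z} → x ≈ y → y ≈ z → x ≈ z
  ≈-trans {x} {y} {z} (q∣-⇒≈ d) (q∣-⇒≈ e) =
    q∣-⇒≈ (subst (+ q ∣_) (x-y+y-z≡x-z x y z) (∣m∣n⇒∣m+n d e))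

  ≈-isEquivalence : IsEquivalence _≈_
  ≈-isEquivalence = record { refl = ≈-refl ; sym = ≈-sym ; trans = ≈-trans }

  ≈-setoid : Setoid _ _
  ≈-setoid = record { isEquivalence = ≈-isEquivalence }

  +-cong : ∀ {x x′ y y′} → x ≈ x′ → y ≈ y′ → x + y ≈ x′ + y′
  +-cong {x} {x′} {y} {y′} (q∣-⇒≈ d) (q∣-⇒≈ e) =
    q∣-⇒≈ (subst (+ q ∣_) (+-difference x x′ y y′) (∣m∣n⇒∣m+n d e))

  *-cong : ∀ {x x′ y y′} → x ≈ x′ → y ≈ y′ → x * y ≈ x′ * y′
  *-cong {x} {x′} {y} {y′} (q∣-⇒≈ d) (q∣-⇒≈ e) =
    q∣-⇒≈ (subst (+ q ∣_) (*-difference x x′ y y′) (∣m∣n⇒∣m+n (∣n⇒∣m*n y d) (∣n⇒∣m*n x′ e)))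

  ^-cong : ∀ {x y} n → x ≈ y → x ^ n ≈ y ^ n
  ^-cong zero    x≈y = ≈-refl
  ^-cong (suc n) x≈y = *-cong x≈y (^-cong n x≈y)

  -cong : ∀ {x x′ y y′} → x ≈ x′ → y ≈ y′ → x - y ≈ x′ - y′
  -cong {x} {x′} {y} {y′} (q∣-⇒≈ d) (q∣-⇒≈ e) =
    q∣-⇒≈ (subst (+ q ∣_) (-cong-difference x x′ y y′) (∣m∣n⇒∣m-n d e))

  +-cancelˡ : ∀ {x y} b → b + x ≈ b + y → x ≈ y
  +-cancelˡ {x} {y} b (q∣-⇒≈ d) = q∣-⇒≈ (subst (+ q ∣_) (+-comm-difference b x y) d)

  +-cancelʳ : ∀ {x y} b → x + b ≈ y + b → x ≈ y
  +-cancelʳ {x} {y} b (q∣-⇒≈ d) = q∣-⇒≈ (subst (+ q ∣_) (+-cancel-difference x y b) d)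

  q∣⇒≈0 : ∀ {x} → + q ∣ x → x ≈ 0ℤ
  q∣⇒≈0 {x} d = q∣-⇒≈ (subst (+ q ∣_) (sym (ℤ.+-identityʳ x)) d)

  ≈0⇒q∣ : ∀ {x} → x ≈ 0ℤ → + q ∣ x
  ≈0⇒q∣ {x} (q∣-⇒≈ d) = subst (+ q ∣_) (ℤ.+-identityʳ x) d

  module _ .{{_ : NonZero q}} where

    %ℕ-≈ : ∀ x → + (x %ℕ q) ≈ x
    %ℕ-≈ x = q∣-⇒≈ (subst (+ q ∣_) eq (∣m⇒∣-m (∣n⇒∣m*n (x /ℕ q) ∣-refl)))
      where
      eq : - ((x /ℕ q) * + q) ≡ + (x %ℕ q) - x
      eq = trans (-[k*d]≡r-[r+k*d] (+ (x %ℕ q)) (x /ℕ q) (+ q))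
                 (cong (λ z → + (x %ℕ q) - z) (sym (a≡a%ℕn+[a/ℕn]*n x q)))

    toℕ-mod≈ : ∀ n → + toℕ (n mod q) ≈ + n
    toℕ-mod≈ n = ≈-trans (≈-reflexive (cong +_ (toℕ-mod n q))) (%ℕ-≈ (+ n))

    q∣n⇒n≡0 : ∀ {n} → n < q → + q ∣ + n → n ≡ 0
    q∣n⇒n≡0 {zero}  _   _   = refl
    q∣n⇒n≡0 {suc n} n<q q∣n = ⊥-elim (ℕ.<⇒≱ n<q (ℕ.∣⇒≤ (∣⇒∣ᵤ q∣n)))

    private
      ≈-residue-≤ : ∀ {a b} → a ≤ b → b < q → + b ≈ + a → a ≡ b
      ≈-residue-≤ {a} {b} a≤b b<q (q∣-⇒≈ d) = ℕ.≤-antisym a≤b (ℕ.m∸n≡0⇒m≤n b∸a≡0)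
        where
        b∸a≡0 : b ℕ.∸ a ≡ 0
        b∸a≡0 = q∣n⇒n≡0 (ℕ.≤-<-trans (ℕ.m∸n≤m b a) b<q)
                  (subst (+ q ∣_) (trans (ℤ.[+m]-[+n]≡m⊖n b a) (ℤ.⊖-≥ a≤b)) d)

    ≈-residue-injective : ∀ {a b} → a < q → b < q → + a ≈ + b → a ≡ b
    ≈-residue-injective {a} {b} a<q b<q a≈b with ℕ.≤-total a b
    ... | inj₁ a≤b = ≈-residue-≤ a≤b b<q (≈-sym a≈b)
    ... | inj₂ b≤a = sym (≈-residue-≤ b≤a a<q a≈b)

    ≈-Fin-injective : ∀ {u v : Fin q} → + toℕ u ≈ + toℕ v → u ≡ v
    ≈-Fin-injective {u} {v} = toℕ-injective ∘ ≈-residue-injective (toℕ<n u) (toℕ<n v)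

  module _ (q-prime : Prime q) where

    q∣*⇒ : ∀ x y → + q ∣ x * y → (+ q ∣ x) ⊎ (+ q ∣ y)
    q∣*⇒ x y q∣xy with euclidsLemma ∣ x ∣ ∣ y ∣ q-prime (subst (q ℕ.∣_) (ℤ.abs-* x y) (∣⇒∣ᵤ q∣xy))
    ... | inj₁ q∣x = inj₁ (∣ᵤ⇒∣ q∣x)
    ... | inj₂ q∣y = inj₂ (∣ᵤ⇒∣ q∣y)

    *-cancelˡ-≈ : ∀ {c x y} → ¬ (+ q ∣ c) → c * x ≈ c * y → x ≈ y
    *-cancelˡ-≈ {c} {x} {y} q∤c (q∣-⇒≈ d)
      with q∣*⇒ c (x - y) (subst (+ q ∣_) (sym (*-distrib-difference c x y)) d)
    ... | inj₁ q∣c   = ⊥-elim (q∤c q∣c)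
    ... | inj₂ q∣x-y = q∣-⇒≈ q∣x-y

    q∤residue : ∀ {n} → 0 < n → n < q → ¬ (+ q ∣ + n)
    q∤residue {n} 0<n n<q q∣n = ℕ.<⇒≢ 0<n (sym (q∣n⇒n≡0 {{ℕ.>-nonZero (ℕ.<-trans 0<n n<q)}} n<q q∣n))

    private
      chord≈0 : ∀ a b c {x y} → a * x * x + b * x + c ≈ 0ℤ → a * y * y + b * y + c ≈ 0ℤ →
                ¬ x ≈ y → a * (x + y) + b ≈ 0ℤ
      chord≈0 a b c {x} {y} fx≈0 fy≈0 x≉y =
        [ (λ q∣x-y → ⊥-elim (x≉y (q∣-⇒≈ q∣x-y))) , q∣⇒≈0 ]′
          (q∣*⇒ (x - y) (a * (x + y) + b)
            (subst (+ q ∣_) (quadratic-difference a b c x y) (≈⇒q∣- (≈-trans fx≈0 (≈-sym fy≈0)))))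

    quadratic-three-roots : ∀ a b c {x y z} →
      a * x * x + b * x + c ≈ 0ℤ → a * y * y + b * y + c ≈ 0ℤ → a * z * z + b * z + c ≈ 0ℤ →
      ¬ x ≈ y → ¬ x ≈ z → ¬ y ≈ z → + q ∣ a
    quadratic-three-roots a b c {x} {y} {z} fx≈0 fy≈0 fz≈0 x≉y x≉z y≉z =
      [ id , (λ q∣y-z → ⊥-elim (y≉z (q∣-⇒≈ q∣y-z))) ]′
        (q∣*⇒ a (y - z) (subst (+ q ∣_) (chord-difference a b x y z)
          (≈⇒q∣- (≈-trans (chord≈0 a b c fx≈0 fy≈0 x≉y) (≈-sym (chord≈0 a b c fx≈0 fz≈0 x≉z))))))

module Sumset (q : ℕ) .{{_ : NonZero q}} (q-prime : Prime q) where

  open import Data.Integer using (_+_; _*_)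
  open Signed using (_∣_)
  open Congruence q
  open SetoidReasoning ≈-setoid

  ι : Fin q → ℤ
  ι v = + toℕ v

  square : Fin q → ℤ
  square v = ι v * ι v

  infixl 6 _+ₘ_
  _+ₘ_ : Fin q → ℕ → Fin q
  v +ₘ b = (toℕ v ℕ.+ b) mod q

  +ₘ-≈ : ∀ v b → ι (v +ₘ b) ≈ ι v + + b
  +ₘ-≈ v b = ≈-trans (toℕ-mod≈ (toℕ v ℕ.+ b)) (≈-reflexive (ℤ.pos-+ (toℕ v) b))

  +ₘ-cancelʳ : ∀ b {v w} → v +ₘ b ≡ w +ₘ b → v ≡ w
  +ₘ-cancelʳ b {v} {w} eq = ≈-Fin-injective (+-cancelʳ (+ b) (begin
    ι v + + b    ≈⟨ ≈-sym (+ₘ-≈ v b) ⟩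
    ι (v +ₘ b)   ≡⟨ cong ι eq ⟩
    ι (w +ₘ b)   ≈⟨ +ₘ-≈ w b ⟩
    ι w + + b    ∎))

  private abstract
    complete-square : ∀ Y₁ Y₂ σ₁ σ₂ M b →
      (M * M + M) * b * b + ((σ₁ + σ₁) - ((Y₁ - σ₁) * M + (Y₁ - σ₁) * M)) * b + ((Y₁ - σ₁) * (Y₁ - σ₁) + σ₂ - Y₂)
        ≡ (Y₁ - (σ₁ + M * b)) * (Y₁ - (σ₁ + M * b)) + (σ₂ + (b * σ₁ + b * σ₁) + M * (b * b)) - Y₂
    complete-square = solve-∀
    [w+c]-c≡w : ∀ w c → (w + c) - c ≡ w
    [w+c]-c≡w = solve-∀
    M*M+M≡M*[M+1] : ∀ M → M * M + M ≡ M * (M + 1ℤ)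
    M*M+M≡M*[M+1] = solve-∀
    translate-sum-step : ∀ a b s m → (a + b) + (s + m * b) ≡ (a + s) + (1ℤ + m) * b
    translate-sum-step = solve-∀
    translate-square-step : ∀ a b s₁ s₂ m →
      (a + b) * (a + b) + (s₂ + (b * s₁ + b * s₁) + m * (b * b))
        ≡ (a * a + s₂) + (b * (a + s₁) + b * (a + s₁)) + (1ℤ + m) * (b * b)
    translate-square-step = solve-∀
    translate-square-base : ∀ b → 0ℤ ≡ 0ℤ + (b * 0ℤ + b * 0ℤ) + 0ℤ * (b * b)
    translate-square-base = solve-∀
    +2*suc : ∀ m k → m ℕ.+ 2 ℕ.* suc k ≡ m ℕ.+ 2 ℕ.* k ℕ.+ 2
    +2*suc = ℕ-Solver.solve-∀

  Σ-translate : ∀ b A → Σ⟨ ι ⟩ (map (_+ₘ b) A) ≈ Σ⟨ ι ⟩ A + + length A * + b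
  Σ-translate b []      = ≈-refl
  Σ-translate b (v ∷ A) = ≈-trans (+-cong (+ₘ-≈ v b) (Σ-translate b A))
    (≈-reflexive (translate-sum-step (ι v) (+ b) (Σ⟨ ι ⟩ A) (+ length A)))

  Σ²-translate : ∀ b A → Σ⟨ square ⟩ (map (_+ₘ b) A)
    ≈ Σ⟨ square ⟩ A + (+ b * Σ⟨ ι ⟩ A + + b * Σ⟨ ι ⟩ A) + + length A * (+ b * + b)
  Σ²-translate b []      = ≈-reflexive (translate-square-base (+ b))
  Σ²-translate b (v ∷ A) = ≈-trans (+-cong (*-cong (+ₘ-≈ v b) (+ₘ-≈ v b)) (Σ²-translate b A))
    (≈-reflexive (translate-square-step (ι v) (+ b) (Σ⟨ ι ⟩ A) (Σ⟨ square ⟩ A) (+ length A)))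

  infixl 6 _⊕_
  _⊕_ : List (Fin q) → List ℕ → List (Fin q)
  A ⊕ B = deduplicate _≟_ (cartesianProductWith _+ₘ_ A B)

  ⊕-unique : ∀ A B → Unique (A ⊕ B)
  ⊕-unique A B = deduplicate-! _≟_ _

  translate-⊆-⊕ : ∀ {A B b} → b ∈ B → map (_+ₘ b) A ⊆ A ⊕ B
  translate-⊆-⊕ b∈B v∈ with a , a∈A , refl ← ∈-map⁻ (_+ₘ _) v∈ =
    ∈-deduplicate⁺ _≟_ (∈-cartesianProductWith⁺ _+ₘ_ a∈A b∈B)

  ∈-⊕⁻ : ∀ A B {v} → v ∈ A ⊕ B → ∃₂ λ a b → a ∈ A × b ∈ B × v ≡ a +ₘ b
  ∈-⊕⁻ A B v∈ = ∈-cartesianProductWith⁻ _+ₘ_ A B (∈-deduplicate⁻ _≟_ _ v∈)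

  module Growth {A : List (Fin q)} {B : List ℕ} (A-unique : Unique A) (A-nonempty : 1 ≤ length A)
                {b₁ b₂ b₃ : ℕ} (b₁∈B : b₁ ∈ B) (b₂∈B : b₂ ∈ B) (b₃∈B : b₃ ∈ B)
                (b₁≉b₂ : ¬ + b₁ ≈ + b₂) (b₁≉b₃ : ¬ + b₁ ≈ + b₃) (b₂≉b₃ : ¬ + b₂ ≈ + b₃) where

    private
      m = length A
      n = length (A ⊕ B)
      M = + m
      σ₁ = Σ⟨ ι ⟩ A
      σ₂ = Σ⟨ square ⟩ A
      Y₁ = Σ⟨ ι ⟩ (A ⊕ B)
      Y₂ = Σ⟨ square ⟩ (A ⊕ B)

      complement : ∀ {b} → b ∈ B → ∃ λ W → A ⊕ B ↭ W ++ map (_+ₘ b) A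
      complement {b} b∈B =
        ⊆-complement (Unique.map⁺ (+ₘ-cancelʳ b) A-unique) (⊕-unique A B) (translate-⊆-⊕ b∈B)

      n≡W+m : ∀ {b W} → A ⊕ B ↭ W ++ map (_+ₘ b) A → n ≡ length W ℕ.+ m
      n≡W+m {b} {W} p = trans (↭-++-length W p) (cong (length W ℕ.+_) (length-map (_+ₘ b) A))

      m≤n : m ≤ n
      m≤n with W , p ← complement b₁∈B = ℕ.≤-trans (ℕ.m≤n+m m (length W)) (ℕ.≤-reflexive (sym (n≡W+m p)))

      q∤M : m < q → ¬ + q ∣ M
      q∤M = q∤residue q-prime A-nonempty

      c₁ c₀ : ℤ
      c₁ = (σ₁ + σ₁) - ((Y₁ - σ₁) * M + (Y₁ - σ₁) * M)
      c₀ = (Y₁ - σ₁) * (Y₁ - σ₁) + σ₂ - Y₂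

    -- If n = m, every translate A + b is all of A ⊕ B, so the sum of A ⊕ B is σ₁ + m b for each b ∈ B.
    n≢m : n < q → n ≢ m
    n≢m n<q n≡m = b₁≉b₂ (*-cancelˡ-≈ q-prime (q∤M (subst (_< q) n≡m n<q))
      (+-cancelˡ σ₁ (≈-trans (≈-sym (sum≈ b₁∈B)) (sum≈ b₂∈B))))
      where
      sum≈ : ∀ {b} → b ∈ B → Y₁ ≈ σ₁ + M * + b
      sum≈ {b} b∈B with complement b∈B
      ... | [] , p    = ≈-trans (≈-reflexive (Σ-↭ ι p)) (Σ-translate b A)
      ... | _ ∷ W , p = ⊥-elim (ℕ.m≢1+n+m m (trans (sym n≡m) (n≡W+m p)))

    -- If n = m + 1, each b ∈ B leaves a single element w = Y₁ − σ₁ − m b of A ⊕ B outside A + b;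
    -- comparing sums of squares makes b a root of a quadratic with leading coefficient m (m + 1).
    private
      translate-root : n ≡ suc m → ∀ {b} → b ∈ B → (M * M + M) * + b * + b + c₁ * + b + c₀ ≈ 0ℤ
      translate-root n≡1+m {b} b∈B with complement b∈B
      ... | [] , p        = ⊥-elim (ℕ.1+n≢n (trans (sym n≡1+m) (n≡W+m p)))
      ... | _ ∷ _ ∷ W , p = ⊥-elim (ℕ.m≢1+n+m m (ℕ.suc-injective (trans (sym n≡1+m) (n≡W+m p))))
      ... | w ∷ [] , p    = begin
        (M * M + M) * + b * + b + c₁ * + b + c₀
          ≡⟨ complete-square Y₁ Y₂ σ₁ σ₂ M (+ b) ⟩
        (Y₁ - (σ₁ + M * + b)) * (Y₁ - (σ₁ + M * + b)) + rest - Y₂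
          ≈⟨ -cong (+-cong (*-cong w≈ w≈) ≈-refl) ≈-refl ⟩
        square w + rest - Y₂
          ≈⟨ -cong (≈-sym Y₂≈) ≈-refl ⟩
        Y₂ - Y₂
          ≡⟨ ℤ.+-inverseʳ Y₂ ⟩
        0ℤ ∎
        where
        rest = σ₂ + (+ b * σ₁ + + b * σ₁) + M * (+ b * + b)
        Y₁≈ : Y₁ ≈ ι w + (σ₁ + M * + b)
        Y₁≈ = ≈-trans (≈-reflexive (Σ-↭ ι p)) (+-cong (≈-refl {ι w}) (Σ-translate b A))
        Y₂≈ : Y₂ ≈ square w + rest
        Y₂≈ = ≈-trans (≈-reflexive (Σ-↭ square p)) (+-cong (≈-refl {square w}) (Σ²-translate b A))
        w≈ : Y₁ - (σ₁ + M * + b) ≈ ι w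
        w≈ = ≈-trans (-cong Y₁≈ ≈-refl) (≈-reflexive ([w+c]-c≡w (ι w) (σ₁ + M * + b)))

    n≢1+m : n < q → n ≢ suc m
    n≢1+m n<q n≡1+m = [ q∤M (ℕ.<-trans (ℕ.n<1+n m) 1+m<q)
                      , q∤residue q-prime (ℕ.m≤n+m 1 m) (subst (_< q) (ℕ.+-comm 1 m) 1+m<q) ]′
      (q∣*⇒ q-prime M (M + 1ℤ) (subst (+ q ∣_) (M*M+M≡M*[M+1] M)
        (quadratic-three-roots q-prime (M * M + M) c₁ c₀ (root b₁∈B) (root b₂∈B) (root b₃∈B) b₁≉b₂ b₁≉b₃ b₂≉b₃)))
      where
      1+m<q = subst (_< q) n≡1+m n<q
      root = translate-root n≡1+m

    ⊕-growth : q ⊓ (m ℕ.+ 2) ≤ n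
    ⊕-growth with ℕ.≤-<-connex q n
    ... | inj₁ q≤n = ℕ.≤-trans (ℕ.m⊓n≤m q _) q≤n
    ... | inj₂ n<q = ℕ.≤-trans (ℕ.m⊓n≤n q _) (subst (_≤ n) (ℕ.+-comm 2 m) 2+m≤n)
      where
      2+m≤n : 2 ℕ.+ m ≤ n
      2+m≤n with ℕ.m≤n⇒m<n∨m≡n m≤n
      ... | inj₂ m≡n = ⊥-elim (n≢m n<q (sym m≡n))
      ... | inj₁ m<n with ℕ.m≤n⇒m<n∨m≡n m<n
      ...   | inj₁ 1+m<n = 1+m<n
      ...   | inj₂ 1+m≡n = ⊥-elim (n≢1+m n<q (sym 1+m≡n))

  Incongruent₃ : ℕ × ℕ × ℕ → Set
  Incongruent₃ (b₁ , b₂ , b₃) = ¬ + b₁ ≈ + b₂ × ¬ + b₁ ≈ + b₃ × ¬ + b₂ ≈ + b₃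

  triple : ℕ × ℕ × ℕ → List ℕ
  triple (b₁ , b₂ , b₃) = b₁ ∷ b₂ ∷ b₃ ∷ []

  ⊕-iterate : List (ℕ × ℕ × ℕ) → List (Fin q) → List (Fin q)
  ⊕-iterate []       A = A
  ⊕-iterate (b ∷ bs) A = ⊕-iterate bs A ⊕ triple b

  ⊕-iterate-unique : ∀ bs {A} → Unique A → Unique (⊕-iterate bs A)
  ⊕-iterate-unique []       A-unique = A-unique
  ⊕-iterate-unique (b ∷ bs) {A} _    = ⊕-unique (⊕-iterate bs A) (triple b)

  ⊕-iterate-growth : ∀ {A} bs → Unique A → 1 ≤ length A → All Incongruent₃ bs →
                     q ⊓ (length A ℕ.+ 2 ℕ.* length bs) ≤ length (⊕-iterate bs A)
  ⊕-iterate-growth {A} [] _ _ [] = ℕ.≤-trans (ℕ.m⊓n≤n q _) (ℕ.≤-reflexive (ℕ.+-identityʳ (length A)))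
  ⊕-iterate-growth {A} (b ∷ bs) A-unique A-nonempty (b-incongruent ∷ bs-incongruent) =
    ℕ.≤-trans (ℕ.≤-reflexive (cong (q ⊓_) (+2*suc (length A) (length bs))))
      (ℕ.≤-trans (⊓-+-mono-≤ 2 ih) (growth b-incongruent))
    where
    Y = ⊕-iterate bs A
    ih = ⊕-iterate-growth bs A-unique A-nonempty bs-incongruent
    Y-nonempty : 1 ≤ length Y
    Y-nonempty = ℕ.≤-trans (ℕ.⊓-glb (ℕ.>-nonZero⁻¹ q) (ℕ.≤-trans A-nonempty (ℕ.m≤m+n _ _))) ih
    growth : Incongruent₃ b → q ⊓ (length Y ℕ.+ 2) ≤ length (Y ⊕ triple b)
    growth (b₁≉b₂ , b₁≉b₃ , b₂≉b₃) =
      Growth.⊕-growth (⊕-iterate-unique bs A-unique) Y-nonempty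
        (here refl) (there (here refl)) (there (there (here refl))) b₁≉b₂ b₁≉b₃ b₂≉b₃

module Order (p q : ℕ) .{{_ : NonZero p}} (p-prime : Prime p) (q-prime : Prime q)
             (r : ℤ) (r^p≈1 : Congruence._≈_ q (r ^ p) 1ℤ) where

  open import Data.Integer using (_*_)
  open Signed using (_∣_; ∣m⇒∣m*n)
  open Congruence q
  open SetoidReasoning ≈-setoid

  private
    r^[c*e]≈1 : ∀ {e} c → r ^ e ≈ 1ℤ → r ^ (c ℕ.* e) ≈ 1ℤ
    r^[c*e]≈1 {e} c r^e≈1 = begin
      r ^ (c ℕ.* e)  ≡⟨ cong (r ^_) (ℕ.*-comm c e) ⟩
      r ^ (e ℕ.* c)  ≡⟨ ℤ.^-*-assoc r e c ⟨
      (r ^ e) ^ c    ≈⟨ ^-cong c r^e≈1 ⟩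
      1ℤ ^ c         ≡⟨ ℤ.^-zeroˡ c ⟩
      1ℤ             ∎

    r^[1+c*e]≈r : ∀ {e} c → r ^ e ≈ 1ℤ → r ^ (1 ℕ.+ c ℕ.* e) ≈ r
    r^[1+c*e]≈r c r^e≈1 = ≈-trans (*-cong (≈-refl {r}) (r^[c*e]≈1 c r^e≈1)) (≈-reflexive (ℤ.*-identityʳ r))

  -- Since p is prime, 1 is a ℤ-combination of e and p, so r^e ≈ 1 would force r ≈ 1.
  ^≉1 : ¬ r ≈ 1ℤ → ∀ {e} → 0 < e → e < p → ¬ r ^ e ≈ 1ℤ
  ^≉1 r≉1 {e@(suc _)} _ e<p r^e≈1 with coprime-Bézout (prime⇒coprime p-prime e<p)
  ... | Bézout.+- a b 1+be≡ap = r≉1 (begin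
    r                    ≈⟨ r^[1+c*e]≈r b r^e≈1 ⟨
    r ^ (1 ℕ.+ b ℕ.* e)  ≡⟨ cong (r ^_) 1+be≡ap ⟩
    r ^ (a ℕ.* p)        ≈⟨ r^[c*e]≈1 a r^p≈1 ⟩
    1ℤ                   ∎)
  ... | Bézout.-+ a b 1+ap≡be = r≉1 (begin
    r                    ≈⟨ r^[1+c*e]≈r a r^p≈1 ⟨
    r ^ (1 ℕ.+ a ℕ.* p)  ≡⟨ cong (r ^_) 1+ap≡be ⟩
    r ^ (b ℕ.* e)        ≈⟨ r^[c*e]≈1 b r^e≈1 ⟩
    1ℤ                   ∎)

  ^-%≈ : ∀ n → r ^ (n % p) ≈ r ^ n
  ^-%≈ n = ≈-sym (begin
    r ^ n                              ≡⟨ cong (r ^_) (m≡m%n+[m/n]*n n p) ⟩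
    r ^ (n % p ℕ.+ n / p ℕ.* p)        ≡⟨ ℤ.^-distribˡ-+-* r (n % p) (n / p ℕ.* p) ⟩
    r ^ (n % p) * r ^ (n / p ℕ.* p)    ≈⟨ *-cong (≈-refl {r ^ (n % p)}) (r^[c*e]≈1 (n / p) r^p≈1) ⟩
    r ^ (n % p) * 1ℤ                   ≡⟨ ℤ.*-identityʳ (r ^ (n % p)) ⟩
    r ^ (n % p)                        ∎)

  q∤^ : ∀ {e} → e ≤ p → ¬ + q ∣ r ^ e
  q∤^ {e} e≤p q∣r^e = q∤residue q-prime (s≤s z≤n) (nonTrivial⇒n>1 q {{prime⇒nonTrivial q-prime}})
    (≈0⇒q∣ (begin
      1ℤ                       ≈⟨ r^p≈1 ⟨
      r ^ p                    ≡⟨ cong (r ^_) (ℕ.m+[n∸m]≡n e≤p) ⟨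
      r ^ (e ℕ.+ (p ℕ.∸ e))    ≡⟨ ℤ.^-distribˡ-+-* r e (p ℕ.∸ e) ⟩
      r ^ e * r ^ (p ℕ.∸ e)    ≈⟨ q∣⇒≈0 (∣m⇒∣m*n (r ^ (p ℕ.∸ e)) q∣r^e) ⟩
      0ℤ                       ∎))

module Products (p q : ℕ) .{{_ : NonZero q}} .{{_ : NonZero p}} (r : ℤ) where

  open import Data.Integer using (_+_; _*_)
  open Congruence q
  open SetoidReasoning ≈-setoid

  infixl 7 _·_
  _·_ : Met q p → Met q p → Met q p
  _·_ = mul q p r

  R : ℕ
  R = rq q p r

  α : Met q p → ℤ
  α g = + toℕ (aexp g)

  τ : Met q p → ℕ
  τ g = toℕ (texp g)

  -- conjugation by τ^k acts on ⟨α⟩ as multiplication by R^k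
  ρ : Fin p → ℤ
  ρ k = + (R ℕ.^ toℕ k)

  α-· : ∀ g h → α (g · h) ≈ α g * ρ (texp h) + α h
  α-· g h = ≈-trans (toℕ-mod≈ (toℕ (aexp g) ℕ.* R ℕ.^ τ h ℕ.+ toℕ (aexp h)))
    (≈-reflexive (trans (ℤ.pos-+ _ (toℕ (aexp h))) (cong (_+ α h) (ℤ.pos-* (toℕ (aexp g)) _))))

  texp-·-G'ˡ : ∀ g h → InG' g → texp (g · h) ≡ texp h
  texp-·-G'ˡ g h g∈G' = trans (cong (λ j → (j ℕ.+ τ h) mod p) g∈G') (toℕ-mod-toℕ (texp h))

  texp-·-G'ʳ : ∀ g h → InG' h → texp (g · h) ≡ texp g
  texp-·-G'ʳ g h h∈G' = trans (cong (λ k → (τ g ℕ.+ k) mod p) h∈G')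
    (trans (cong (_mod p) (ℕ.+-identityʳ (τ g))) (toℕ-mod-toℕ (texp g)))

  P : List (Met q p) → Met q p
  P = prod q p r

  texp-P-G'++ : ∀ {X} L → All InG' X → texp (P (X ++ L)) ≡ texp (P L)
  texp-P-G'++ L []              = refl
  texp-P-G'++ {u ∷ X} L (u∈G' ∷ X⊆G') = trans (texp-·-G'ˡ u (P (X ++ L)) u∈G') (texp-P-G'++ L X⊆G')

  private abstract
    α-step : ∀ a ρ S z → a * ρ + (S * ρ + z) ≡ (a + S) * ρ + z
    α-step = solve-∀
    S*1+0≡S : ∀ S → S * 1ℤ + 0ℤ ≡ S
    S*1+0≡S = solve-∀
    arrangement-assoc : ∀ a b c d e → a + (b + (c + (d + e))) ≡ a + b + c + d + e
    arrangement-assoc = solve-∀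

  α-P-G'++ : ∀ {X} L → All InG' X → α (P (X ++ L)) ≈ Σ⟨ α ⟩ X * ρ (texp (P L)) + α (P L)
  α-P-G'++ L [] = ≈-reflexive (sym (ℤ.+-identityˡ (α (P L))))
  α-P-G'++ {u ∷ X} L (u∈G' ∷ X⊆G') = begin
    α (u · P (X ++ L))
      ≈⟨ α-· u (P (X ++ L)) ⟩
    α u * ρ (texp (P (X ++ L))) + α (P (X ++ L))
      ≡⟨ cong (λ j → α u * ρ j + α (P (X ++ L))) (texp-P-G'++ L X⊆G') ⟩
    α u * ρ (texp (P L)) + α (P (X ++ L))
      ≈⟨ +-cong (≈-refl {α u * ρ (texp (P L))}) (α-P-G'++ L X⊆G') ⟩
    α u * ρ (texp (P L)) + (Σ⟨ α ⟩ X * ρ (texp (P L)) + α (P L))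
      ≡⟨ α-step (α u) (ρ (texp (P L))) (Σ⟨ α ⟩ X) (α (P L)) ⟩
    Σ⟨ α ⟩ (u ∷ X) * ρ (texp (P L)) + α (P L)
      ∎

  τ-P-G' : ∀ {X} → All InG' X → τ (P X) ≡ 0
  τ-P-G' {X} X⊆G' = subst (λ Y → τ (P Y) ≡ 0) (++-identityʳ X)
    (trans (cong toℕ (texp-P-G'++ [] X⊆G')) (trans (toℕ-mod 0 p) (m<n⇒m%n≡m (ℕ.>-nonZero⁻¹ p))))

  α-P-G' : ∀ {X} → All InG' X → α (P X) ≈ Σ⟨ α ⟩ X
  α-P-G' {X} X⊆G' = begin
    α (P X)                                  ≡⟨ cong (α ∘ P) (++-identityʳ X) ⟨
    α (P (X ++ []))                          ≈⟨ α-P-G'++ [] X⊆G' ⟩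
    Σ⟨ α ⟩ X * ρ (texp (P [])) + α (P [])
      ≈⟨ +-cong (≈-reflexive (cong (λ k → Σ⟨ α ⟩ X * + (R ℕ.^ k)) (τ-P-G' {[]} []))) (toℕ-mod≈ 0) ⟩
    Σ⟨ α ⟩ X * 1ℤ + 0ℤ                       ≡⟨ S*1+0≡S (Σ⟨ α ⟩ X) ⟩
    Σ⟨ α ⟩ X                                 ∎

  module Arranged (g₁ g₂ : Met q p) where

    s t : ℤ
    s = ρ (texp g₂)
    t = ρ (texp (g₁ · g₂))

    arrangement : (As Bs Cs : List (Met q p)) → ℤ
    arrangement As Bs Cs = Σ⟨ α ⟩ As * t + α g₁ * s + Σ⟨ α ⟩ Bs * s + α g₂ + Σ⟨ α ⟩ Cs

    module _ {As Bs Cs : List (Met q p)} (As⊆G' : All InG' As) (Bs⊆G' : All InG' Bs) (Cs⊆G' : All InG' Cs) where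

      private
        texp-g₂Cs : texp (P (g₂ ∷ Cs)) ≡ texp g₂
        texp-g₂Cs = texp-·-G'ʳ g₂ (P Cs) (τ-P-G' Cs⊆G')

        texp-Bsg₂Cs : texp (P (Bs ++ g₂ ∷ Cs)) ≡ texp g₂
        texp-Bsg₂Cs = trans (texp-P-G'++ (g₂ ∷ Cs) Bs⊆G') texp-g₂Cs

      texp-P-arrangement : texp (P (As ++ g₁ ∷ Bs ++ g₂ ∷ Cs)) ≡ texp (g₁ · g₂)
      texp-P-arrangement = trans (texp-P-G'++ (g₁ ∷ Bs ++ g₂ ∷ Cs) As⊆G')
                                 (cong (λ j → (τ g₁ ℕ.+ toℕ j) mod p) texp-Bsg₂Cs)

      α-P-arrangement : α (P (As ++ g₁ ∷ Bs ++ g₂ ∷ Cs)) ≈ arrangement As Bs Cs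
      α-P-arrangement = begin
        α (P (As ++ g₁ ∷ Q))
          ≈⟨ α-P-G'++ (g₁ ∷ Q) As⊆G' ⟩
        Σ⟨ α ⟩ As * ρ (texp (g₁ · P Q)) + α (g₁ · P Q)
          ≈⟨ +-cong (≈-reflexive (cong (Σ⟨ α ⟩ As *_) ρ-g₁Q)) (α-· g₁ (P Q)) ⟩
        Σ⟨ α ⟩ As * t + (α g₁ * ρ (texp (P Q)) + α (P Q))
          ≈⟨ +-cong (≈-refl {Σ⟨ α ⟩ As * t}) (+-cong (≈-reflexive (cong (α g₁ *_) (cong ρ texp-Bsg₂Cs))) α-Q) ⟩
        Σ⟨ α ⟩ As * t + (α g₁ * s + (Σ⟨ α ⟩ Bs * s + (α g₂ + Σ⟨ α ⟩ Cs)))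
          ≡⟨ arrangement-assoc (Σ⟨ α ⟩ As * t) (α g₁ * s) (Σ⟨ α ⟩ Bs * s) (α g₂) (Σ⟨ α ⟩ Cs) ⟩
        arrangement As Bs Cs
          ∎
        where
        Q = Bs ++ g₂ ∷ Cs
        ρ-g₁Q : ρ (texp (g₁ · P Q)) ≡ t
        ρ-g₁Q = cong ρ (cong (λ j → (τ g₁ ℕ.+ toℕ j) mod p) texp-Bsg₂Cs)
        α-g₂Cs : α (P (g₂ ∷ Cs)) ≈ α g₂ + Σ⟨ α ⟩ Cs
        α-g₂Cs = begin
          α (g₂ · P Cs)                      ≈⟨ α-· g₂ (P Cs) ⟩
          α g₂ * ρ (texp (P Cs)) + α (P Cs)
            ≈⟨ +-cong (≈-reflexive (cong (λ k → α g₂ * + (R ℕ.^ k)) (τ-P-G' Cs⊆G'))) (α-P-G' Cs⊆G') ⟩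
          α g₂ * 1ℤ + Σ⟨ α ⟩ Cs              ≡⟨ cong (_+ Σ⟨ α ⟩ Cs) (ℤ.*-identityʳ (α g₂)) ⟩
          α g₂ + Σ⟨ α ⟩ Cs                   ∎
        α-Q : α (P Q) ≈ Σ⟨ α ⟩ Bs * s + (α g₂ + Σ⟨ α ⟩ Cs)
        α-Q = begin
          α (P Q)                                               ≈⟨ α-P-G'++ (g₂ ∷ Cs) Bs⊆G' ⟩
          Σ⟨ α ⟩ Bs * ρ (texp (P (g₂ ∷ Cs))) + α (P (g₂ ∷ Cs))
            ≈⟨ +-cong (≈-reflexive (cong (Σ⟨ α ⟩ Bs *_) (cong ρ texp-g₂Cs))) α-g₂Cs ⟩
          Σ⟨ α ⟩ Bs * s + (α g₂ + Σ⟨ α ⟩ Cs)                    ∎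

module Reachable (p q : ℕ) .{{_ : NonZero q}} .{{_ : NonZero p}} (p-prime : Prime p) (q-prime : Prime q)
                 (r : ℤ) (r^p≈1 : Congruence._≈_ q (r ^ p) 1ℤ) (r≉1 : ¬ Congruence._≈_ q r 1ℤ)
                 (g₁ g₂ : Met q p) (g₁∉G' : ¬ InG' g₁) (g₂∉G' : ¬ InG' g₂) (g₁g₂∉G' : ¬ InG' (mul q p r g₁ g₂)) where

  open import Data.Integer using (_+_; _*_)
  open Congruence q
  open Sumset q q-prime
  open Products p q r
  open Arranged g₁ g₂
  open Order p q p-prime q-prime r r^p≈1 using (^≉1; ^-%≈; q∤^)
  open SetoidReasoning ≈-setoid

  private
    j k τ₀ : ℕ
    j  = τ g₁
    k  = τ g₂
    τ₀ = τ (g₁ · g₂)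

    R^≈ : ∀ e → + (R ℕ.^ e) ≈ r ^ e
    R^≈ e = ≈-trans (≈-reflexive (pos-^ R e)) (^-cong e (%ℕ-≈ r))

    ρ≉1 : ∀ g → ¬ InG' g → ¬ ρ (texp g) ≈ 1ℤ
    ρ≉1 g g∉G' ρ≈1 = ^≉1 r≉1 (ℕ.n≢0⇒n>0 g∉G') (toℕ<n (texp g)) (≈-trans (≈-sym (R^≈ (τ g))) ρ≈1)

  s≉1 : ¬ s ≈ 1ℤ
  s≉1 = ρ≉1 g₂ g₂∉G'

  t≉1 : ¬ t ≈ 1ℤ
  t≉1 = ρ≉1 (g₁ · g₂) g₁g₂∉G'

  -- t ≈ r^(j+k) and s ≈ r^k, and r^k is invertible modulo q
  t≉s : ¬ t ≈ s
  t≉s t≈s = ^≉1 r≉1 (ℕ.n≢0⇒n>0 g₁∉G') (toℕ<n (texp g₁))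
    (*-cancelˡ-≈ q-prime (q∤^ (ℕ.<⇒≤ (toℕ<n (texp g₂)))) (begin
      r ^ k * r ^ j           ≡⟨ ℤ.^-distribˡ-+-* r k j ⟨
      r ^ (k ℕ.+ j)           ≡⟨ cong (r ^_) (ℕ.+-comm k j) ⟩
      r ^ (j ℕ.+ k)           ≈⟨ ^-%≈ (j ℕ.+ k) ⟨
      r ^ ((j ℕ.+ k) ℕ.% p)   ≡⟨ cong (r ^_) (toℕ-mod (j ℕ.+ k) p) ⟨
      r ^ τ₀                  ≈⟨ R^≈ τ₀ ⟨
      t                       ≈⟨ t≈s ⟩
      s                       ≈⟨ R^≈ k ⟩
      r ^ k                   ≡⟨ ℤ.*-identityʳ (r ^ k) ⟨
      r ^ k * 1ℤ              ∎))

  shifts : Met q p → ℕ × ℕ × ℕ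
  shifts u = a ℕ.* (R ℕ.^ τ₀) , a ℕ.* (R ℕ.^ k) , a ℕ.* 1
    where a = toℕ (aexp u)

  private
    scaled-≉ : ∀ {a x y} → 0 < a → a < q → ¬ + x ≈ + y → ¬ + (a ℕ.* x) ≈ + (a ℕ.* y)
    scaled-≉ {a} {x} {y} 0<a a<q x≉y ax≈ay = x≉y (*-cancelˡ-≈ q-prime (q∤residue q-prime 0<a a<q)
      (≈-trans (≈-reflexive (sym (ℤ.pos-* a x))) (≈-trans ax≈ay (≈-reflexive (ℤ.pos-* a y)))))

  shifts-incongruent : ∀ {u} → InG' u → ¬ IsOne u → Incongruent₃ (shifts u)
  shifts-incongruent {u} u∈G' u≢1 = scaled-≉ 0<a a<q t≉s , scaled-≉ 0<a a<q t≉1 , scaled-≉ 0<a a<q s≉1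
    where
    0<a = ℕ.n≢0⇒n>0 (λ a≡0 → u≢1 (a≡0 , u∈G'))
    a<q = toℕ<n (aexp u)

  record Arrangement (S : List (Met q p)) (v : Fin q) : Set where
    field
      As Bs Cs : List (Met q p)
      As⊆G'    : All InG' As
      Bs⊆G'    : All InG' Bs
      Cs⊆G'    : All InG' Cs
      reorders : As ++ g₁ ∷ Bs ++ g₂ ∷ Cs ↭ g₁ ∷ g₂ ∷ S
      α-value  : ι v ≈ arrangement As Bs Cs

  arrangement⇒∈π : ∀ {S v} → Arrangement S v → _∈π_ q p r ⟨ v , texp (g₁ · g₂) ⟩ (g₁ ∷ g₂ ∷ S)
  arrangement⇒∈π record { As⊆G' = As⊆G' ; Bs⊆G' = Bs⊆G' ; Cs⊆G' = Cs⊆G' ; reorders = reorders ; α-value = α-value } =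
    _ , reorders , cong₂ ⟨_,_⟩ (≈-Fin-injective (≈-trans (α-P-arrangement As⊆G' Bs⊆G' Cs⊆G') (≈-sym α-value)))
                               (texp-P-arrangement As⊆G' Bs⊆G' Cs⊆G')

  private abstract
    start-value : ∀ x y s t → x * s + y ≡ 0ℤ * t + x * s + 0ℤ * s + y + 0ℤ
    start-value = solve-∀
    into-As : ∀ A X B Y C a t s → (A * t + X * s + B * s + Y + C) + a * t ≡ (a + A) * t + X * s + B * s + Y + C
    into-As = solve-∀
    into-Bs : ∀ A X B Y C a t s → (A * t + X * s + B * s + Y + C) + a * s ≡ A * t + X * s + (a + B) * s + Y + C
    into-Bs = solve-∀
    into-Cs : ∀ A X B Y C a t s → (A * t + X * s + B * s + Y + C) + a * 1ℤ ≡ A * t + X * s + B * s + Y + (a + C)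
    into-Cs = solve-∀

  private
    move-front : ∀ xs y {u : Met q p} {zs} → xs ++ y ∷ u ∷ zs ↭ u ∷ xs ++ y ∷ zs
    move-front xs y {u} {zs} = ↭-trans (++⁺ˡ xs (↭-swap y u ↭-refl)) (shift u xs (y ∷ zs))

    extend : ∀ {L S} u → L ↭ g₁ ∷ g₂ ∷ S → u ∷ L ↭ g₁ ∷ g₂ ∷ u ∷ S
    extend {S = S} u L↭ = ↭-trans (↭-prep u L↭) (↭-sym (shift u (g₁ ∷ g₂ ∷ []) S))

    shifted : ∀ w u c {V} → ι w ≈ V → ι (w +ₘ toℕ (aexp u) ℕ.* c) ≈ V + α u * + c
    shifted w u c w≈V = ≈-trans (+ₘ-≈ w _) (+-cong w≈V (≈-reflexive (ℤ.pos-* (toℕ (aexp u)) c)))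

  arranged-g₁g₂ : Arrangement [] (aexp (g₁ · g₂))
  arranged-g₁g₂ = record
    { As = [] ; Bs = [] ; Cs = [] ; As⊆G' = [] ; Bs⊆G' = [] ; Cs⊆G' = [] ; reorders = ↭-refl
    ; α-value = ≈-trans (α-· g₁ g₂) (≈-reflexive (start-value (α g₁) (α g₂) s t)) }

  module _ {S : List (Met q p)} {w : Fin q} {u : Met q p} (u∈G' : InG' u) (A : Arrangement S w) where
    open Arrangement A

    insert-As : Arrangement (u ∷ S) (w +ₘ proj₁ (shifts u))
    insert-As = record
      { As = u ∷ As ; Bs = Bs ; Cs = Cs ; As⊆G' = u∈G' ∷ As⊆G' ; Bs⊆G' = Bs⊆G' ; Cs⊆G' = Cs⊆G'
      ; reorders = extend u reorders
      ; α-value  = ≈-trans (shifted w u (R ℕ.^ τ₀) α-value)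
          (≈-reflexive (into-As (Σ⟨ α ⟩ As) (α g₁) (Σ⟨ α ⟩ Bs) (α g₂) (Σ⟨ α ⟩ Cs) (α u) t s)) }

    insert-Bs : Arrangement (u ∷ S) (w +ₘ proj₁ (proj₂ (shifts u)))
    insert-Bs = record
      { As = As ; Bs = u ∷ Bs ; Cs = Cs ; As⊆G' = As⊆G' ; Bs⊆G' = u∈G' ∷ Bs⊆G' ; Cs⊆G' = Cs⊆G'
      ; reorders = ↭-trans (move-front As g₁) (extend u reorders)
      ; α-value  = ≈-trans (shifted w u (R ℕ.^ k) α-value)
          (≈-reflexive (into-Bs (Σ⟨ α ⟩ As) (α g₁) (Σ⟨ α ⟩ Bs) (α g₂) (Σ⟨ α ⟩ Cs) (α u) t s)) }

    insert-Cs : Arrangement (u ∷ S) (w +ₘ proj₂ (proj₂ (shifts u)))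
    insert-Cs = record
      { As = As ; Bs = Bs ; Cs = u ∷ Cs ; As⊆G' = As⊆G' ; Bs⊆G' = Bs⊆G' ; Cs⊆G' = u∈G' ∷ Cs⊆G'
      ; reorders = ↭-trans (++⁺ˡ As (↭-prep g₁ (move-front Bs g₂))) (↭-trans (move-front As g₁) (extend u reorders))
      ; α-value  = ≈-trans (shifted w u 1 α-value)
          (≈-reflexive (into-Cs (Σ⟨ α ⟩ As) (α g₁) (Σ⟨ α ⟩ Bs) (α g₂) (Σ⟨ α ⟩ Cs) (α u) t s)) }

  reachable : List (Met q p) → List (Fin q)
  reachable S = ⊕-iterate (map shifts S) [ aexp (g₁ · g₂) ]

  reachable-arranged : ∀ {S} → All InG' S → ∀ {v} → v ∈ reachable S → Arrangement S v
  reachable-arranged []                (here refl) = arranged-g₁g₂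
  reachable-arranged {u ∷ S} (u∈G' ∷ S⊆G') v∈ with ∈-⊕⁻ (reachable S) (triple (shifts u)) v∈
  ... | w , _ , w∈ , here refl                 , refl = insert-As u∈G' (reachable-arranged S⊆G' w∈)
  ... | w , _ , w∈ , there (here refl)         , refl = insert-Bs u∈G' (reachable-arranged S⊆G' w∈)
  ... | w , _ , w∈ , there (there (here refl)) , refl = insert-Cs u∈G' (reachable-arranged S⊆G' w∈)

  reachable-unique : ∀ S → Unique (reachable S)
  reachable-unique S = ⊕-iterate-unique (map shifts S) ([] ∷ [])

  reachable-growth : ∀ {S} → All (λ u → InG' u × ¬ IsOne u) S →
                     q ⊓ (2 ℕ.* length S ℕ.+ 1) ≤ length (reachable S)
  reachable-growth {S} S⊆G'∖1 =
    subst (λ n → q ⊓ n ≤ length (reachable S))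
      (trans (ℕ.+-comm 1 _) (cong (λ n → 2 ℕ.* n ℕ.+ 1) (length-map shifts S)))
      (⊕-iterate-growth (map shifts S) ([] ∷ []) ℕ.≤-refl
        (All.map⁺ (All.map (λ (u∈G' , u≢1) → shifts-incongruent u∈G' u≢1) S⊆G'∖1)))

open import Data.Nat using (ℕ; _∸_; _≤_; _⊔_; _⊓_; _*_; _+_; NonZero)
open import Data.Nat.Divisibility using () renaming (_∣_ to _∣ℕ_)
open import Data.Nat.Primality using (Prime)
open import Data.Integer using (ℤ; +_; _-_; _^_; 1ℤ)
open import Data.Integer.Divisibility using (_∣_)
open import Data.List using (List; _∷_; length)
open import Data.List.Relation.Unary.All using (All)
open import Data.List.Relation.Unary.Unique.Propositional using (Unique)
open import Data.Product using (Σ; _×_)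
open import Relation.Nullary using (¬_)

lemma5p4 : (p q : ℕ) .{{_ : NonZero q}} .{{_ : NonZero p}} → Prime p → Prime q → p ∣ℕ (q ∸ 1)
    → (r : ℤ) → (+ q) ∣ ((r ^ p) - 1ℤ) → ¬ ((+ q) ∣ (r - 1ℤ))
    → (S : List (Met q p)) → All (λ x → InG' x × ¬ IsOne x) S
    → (g₁ g₂ : Met q p) → ¬ InG' g₁ → ¬ InG' g₂ → ¬ InG' (mul q p r g₁ g₂)
    → Σ (List (Met q p)) λ L → Unique L
        × All (λ g → _∈π_ q p r g (g₁ ∷ g₂ ∷ S)) L
        × (q ⊓ (2 * length S + 1)) ≤ length L
lemma5p4 p q p-prime q-prime _ r q∣r^p-1 q∤r-1 S S⊆G'∖1 g₁ g₂ g₁∉G' g₂∉G' g₁g₂∉G' =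
  map (λ v → ⟨ v , texp (mul q p r g₁ g₂) ⟩) (reachable S) ,
  Unique.map⁺ (cong aexp) (reachable-unique S) ,
  All.map⁺ (tabulate (arrangement⇒∈π ∘ reachable-arranged (All.map proj₁ S⊆G'∖1))) ,
  subst (q ⊓ (2 * length S + 1) ≤_) (sym (length-map _ (reachable S))) (reachable-growth S⊆G'∖1)
  where
  open Congruence q using (q∣-⇒≈)
  open Reachable p q p-prime q-prime r (q∣-⇒≈ (Signed.∣ᵤ⇒∣ q∣r^p-1)) (λ (q∣-⇒≈ q∣r-1) → q∤r-1 (Signed.∣⇒∣ᵤ q∣r-1))
                 g₁ g₂ g₁∉G' g₂∉G' g₁g₂∉G'
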